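{- Let $C$ be a dendritic face complex. For every $a\in C$ with $\dim a\ge2$, $$\{\gamma(\gamma(a))\}=\gamma\delta(a)\setminus\delta\delta(a)\qquad\text{and}\qquad\delta(\gamma(a))=\delta\delta(a)\setminus\gamma\delta(a),$$ where $\gamma\delta(a)=\{\gamma(x):x\in\delta(a)\}$ and $\delta\delta(a)=\bigcup_{x\in\delta(a)}\delta(x)$.
   Context: A positive-to-one poset (POP) is a finite set $P$ with $\dim:P\to\mathbb{N}$ and binary relations $\prec^-,\prec^+$; $y\prec x$ means $y\prec^-x$ or $y\prec^+x$. Axioms: $y\prec x\Rightarrow\dim x=\dim y+1$; never both $y\prec^-x$ and $y\prec^+x$; every $x$ with $\dim x\ge1$ has exactly one $y$ with $y\prec^+x$, denoted $\gamma(x)$, and at least one $y$ with $y\prec^-x$. $\delta(x)=\{y:y\prec^-x\}$; $\le$ is the reflexive-transitive closure of $\prec$. A dendritic face complex is a POP such that: $(P,\le)$ has a greatest element; (oriented thinness) whenever $z\prec^{\beta}y\prec^{\alpha}x$ there is a unique $y'\ne y$ with $z\prec y'\prec x$, and writing $z\prec^{\beta'}y'\prec^{\alpha'}x$ the signs (as $\pm1$) satisfy $\alpha\beta=-\alpha'\beta'$; (acyclicity) $\delta(x)$ is a singleton if $\dim x=1$, nonempty if $\dim x\ge1$, and for $\dim x\ge1$ there are no $p\ge1$, $y_1,\dots,y_p\in\delta(x)$ with $\gamma(y_{i+1})\in\delta(y_i)$ ($1\le i<p$) and $\gamma(y_1)\in\delta(y_p)$. -}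

module Defs where

open import Data.Nat using (ℕ; zero; suc; _≤_)
open import Data.Fin using (Fin; inject₁; fromℕ) renaming (zero to fz; suc to fs)
open import Data.Product using (Σ; ∃; _×_; _,_)
open import Data.Sum using (_⊎_)
open import Data.Empty using (⊥)
open import Relation.Nullary using (¬_; Dec)
open import Relation.Binary.PropositionalEquality using (_≡_; _≢_)
open import Relation.Binary.Construct.Closure.ReflexiveTransitive using (Star)

data Sign : Set where
  minus plus : Sign

_·_ : Sign → Sign → Sign
minus · minus = plus
minus · plus  = minus
plus  · s     = s

neg : Sign → Sign
neg minus = plus
neg plus  = minus

relBy : {A : Set} → (A → A → Set) → (A → A → Set) → Sign → A → A → Set
relBy m p minus = m
relBy m p plus  = p

-- A positive-to-one poset on the finite carrier Fin n.
-- The unique plus-face is given as a function γ together with its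
-- specification (meaningful only for dim x ≥ 1).
record POP (n : ℕ) : Set₁ where
  field
    dim  : Fin n → ℕ
    _≺⁻_ : Fin n → Fin n → Set
    _≺⁺_ : Fin n → Fin n → Set
    ≺⁻-dec : ∀ y x → Dec (y ≺⁻ x)
    ≺⁺-dec : ∀ y x → Dec (y ≺⁺ x)

  _≺_ : Fin n → Fin n → Set
  y ≺ x = (y ≺⁻ x) ⊎ (y ≺⁺ x)

  rel : Sign → Fin n → Fin n → Set
  rel s y x = relBy _≺⁻_ _≺⁺_ s y x

  field
    dim-≺    : ∀ {y x} → y ≺ x → dim x ≡ suc (dim y)
    not-both : ∀ {y x} → y ≺⁻ x → y ≺⁺ x → ⊥
    γ        : Fin n → Fin n
    γ-face   : ∀ x → 1 ≤ dim x → γ x ≺⁺ x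
    γ-unique : ∀ x → 1 ≤ dim x → ∀ y → y ≺⁺ x → y ≡ γ x
    δ-nonempty : ∀ x → 1 ≤ dim x → ∃ λ y → y ≺⁻ x

  _≼_ : Fin n → Fin n → Set
  _≼_ = Star _≺_

record DendriticFaceComplex (n : ℕ) : Set₁ where
  field
    pop : POP n
  open POP pop public
  field
    greatest : ∃ λ top → ∀ x → x ≼ top
    oriented-thin :
      ∀ α β x y z → rel β z y → rel α y x →
      Σ (Fin n) λ y' → (y' ≢ y) × (z ≺ y') × (y' ≺ x)
        × (∀ y'' → y'' ≢ y → z ≺ y'' → y'' ≺ x → y'' ≡ y')
        × (∀ α' β' → rel β' z y' → rel α' y' x → α · β ≡ neg (α' · β'))
    δ-singleton-dim1 :
      ∀ x → dim x ≡ 1 → ∃ λ y → (y ≺⁻ x) × (∀ y' → y' ≺⁻ x → y' ≡ y)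
    acyclic :
      ∀ x → 1 ≤ dim x → ∀ k (ys : Fin (suc k) → Fin n) →
      (∀ i → ys i ≺⁻ x) →
      (∀ (i : Fin k) → γ (ys (fs i)) ≺⁻ ys (inject₁ i)) →
      γ (ys fz) ≺⁻ ys (fromℕ k) → ⊥

{-# OPTIONS --safe #-}
-- For z ≺ γ(a) ≺ a, thinness yields a second face y' of a
-- above z, which is not γ(a) and hence lies in δ(a); the sign rule then decides whether
-- z = γ(y') or z ∈ δ(y').  Both cannot happen for faces of γ(a), since otherwise z would lie
-- below three distinct faces of a.
module Submission where

open import Defs
open import Data.Nat using (_≤_; z≤n; s≤s)
open import Data.Nat.Properties using (≤-pred; ≤-trans; n≤1+n)
open import Data.Fin using (Fin)
open import Data.Product using (Σ; ∃; ∃₂; _×_; _,_; uncurry)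
open import Data.Sum using (inj₁; inj₂)
open import Data.Empty using (⊥; ⊥-elim)
open import Relation.Nullary using (¬_)
open import Relation.Binary.PropositionalEquality
  using (_≡_; _≢_; ≢-sym; refl; sym; trans; subst; cong)
open import Function.Bundles using (_⇔_; mk⇔)

neg-involutive : ∀ s → neg (neg s) ≡ s
neg-involutive minus = refl
neg-involutive plus  = refl

OrientedThin : ∀ {n} → POP n → Set
OrientedThin {n} P =
  ∀ α β x y z → rel β z y → rel α y x →
  Σ (Fin n) λ y' → (y' ≢ y) × (z ≺ y') × (y' ≺ x)
    × (∀ y'' → y'' ≢ y → z ≺ y'' → y'' ≺ x → y'' ≡ y')
    × (∀ α' β' → rel β' z y' → rel α' y' x → α · β ≡ neg (α' · β'))
  where open POP P

module OrientedThinPOP {n} (P : POP n) (thin : OrientedThin P) where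
  open POP P

  ≺⇒rel : ∀ {y x} → y ≺ x → ∃ λ α → rel α y x
  ≺⇒rel (inj₁ y≺⁻x) = minus , y≺⁻x
  ≺⇒rel (inj₂ y≺⁺x) = plus , y≺⁺x

  ≺⇒1≤dim : ∀ {y x} → y ≺ x → 1 ≤ dim x
  ≺⇒1≤dim y≺x rewrite dim-≺ y≺x = s≤s z≤n

  ≺⇒1≤dim-face : ∀ {y x} → y ≺ x → 2 ≤ dim x → 1 ≤ dim y
  ≺⇒1≤dim-face y≺x 2≤dim = ≤-pred (subst (2 ≤_) (dim-≺ y≺x) 2≤dim)

  ≺⁺⇒≡γ : ∀ {y x} → y ≺⁺ x → y ≡ γ x
  ≺⁺⇒≡γ {y} {x} y≺⁺x = γ-unique x (≺⇒1≤dim (inj₂ y≺⁺x)) y y≺⁺x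

  ≺⁻⇒≢γ : ∀ {y x} → y ≺⁻ x → y ≢ γ x
  ≺⁻⇒≢γ {x = x} y≺⁻x refl = not-both y≺⁻x (γ-face x (≺⇒1≤dim (inj₁ y≺⁻x)))

  ≺⁻-≺⁺⇒≢ : ∀ {z y y'} → z ≺⁻ y → z ≺⁺ y' → y ≢ y'
  ≺⁻-≺⁺⇒≢ z≺⁻y z≺⁺y refl = not-both z≺⁻y z≺⁺y

  partner : ∀ α β {x y z} → rel β z y → rel α y x →
            ∃ λ y' → y' ≢ y × ∃₂ λ α' β' → rel β' z y' × rel α' y' x × α' · β' ≡ neg (α · β)
  partner α β {x} {y} {z} z≺y y≺x with thin α β x y z z≺y y≺x
  ... | y' , y'≢y , z≺y' , y'≺x , _ , sign-rule with ≺⇒rel z≺y' | ≺⇒rel y'≺x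
  ... | β' , z≺y'' | α' , y'≺x' =
    y' , y'≢y , α' , β' , z≺y'' , y'≺x' ,
    trans (sym (neg-involutive (α' · β'))) (cong neg (sym (sign-rule α' β' z≺y'' y'≺x')))

  ≺-between-at-most-two : ∀ {x z y₁ y₂ y₃} →
    z ≺ y₁ → y₁ ≺ x → z ≺ y₂ → y₂ ≺ x → z ≺ y₃ → y₃ ≺ x →
    y₁ ≢ y₂ → y₁ ≢ y₃ → y₂ ≡ y₃
  ≺-between-at-most-two {x} {z} {y₁} z≺y₁ y₁≺x z≺y₂ y₂≺x z≺y₃ y₃≺x y₁≢y₂ y₁≢y₃
    with ≺⇒rel z≺y₁ | ≺⇒rel y₁≺x
  ... | β , z≺y₁' | α , y₁≺x' with thin α β x y₁ z z≺y₁' y₁≺x'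
  ... | _ , _ , _ , _ , unique , _ =
    trans (unique _ (≢-sym y₁≢y₂) z≺y₂ y₂≺x) (sym (unique _ (≢-sym y₁≢y₃) z≺y₃ y₃≺x))

  _∈γδ_ : Fin n → Fin n → Set
  z ∈γδ a = ∃ λ x → (x ≺⁻ a) × (γ x ≡ z)

  _∈δδ_ : Fin n → Fin n → Set
  z ∈δδ a = ∃ λ x → (x ≺⁻ a) × (z ≺⁻ x)

  module _ {a : Fin n} (2≤dim-a : 2 ≤ dim a) where

    private
      γa≺⁺a : γ a ≺⁺ a
      γa≺⁺a = γ-face a (≤-trans (n≤1+n 1) 2≤dim-a)

      γγa≺⁺γa : γ (γ a) ≺⁺ γ a
      γγa≺⁺γa = γ-face (γ a) (≺⇒1≤dim-face (inj₂ γa≺⁺a) 2≤dim-a)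

      γ-≺⁺-face : ∀ {x} → x ≺⁻ a → γ x ≺⁺ x
      γ-≺⁺-face {x} x≺⁻a = γ-face x (≺⇒1≤dim-face (inj₁ x≺⁻a) 2≤dim-a)

    face-of-γ-∉γδ∩δδ : ∀ {z} → z ≺ γ a → z ∈γδ a → z ∈δδ a → ⊥
    face-of-γ-∉γδ∩δδ z≺γa (x , x≺⁻a , refl) (y , y≺⁻a , z≺⁻y) =
      ≺⁻-≺⁺⇒≢ z≺⁻y (γ-≺⁺-face x≺⁻a)
        (sym (≺-between-at-most-two z≺γa (inj₂ γa≺⁺a)
                (inj₂ (γ-≺⁺-face x≺⁻a)) (inj₁ x≺⁻a) (inj₁ z≺⁻y) (inj₁ y≺⁻a)
                (≢-sym (≺⁻⇒≢γ x≺⁻a)) (≢-sym (≺⁻⇒≢γ y≺⁻a))))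

    γγ∈γδ : γ (γ a) ∈γδ a
    γγ∈γδ with partner plus plus γγa≺⁺γa γa≺⁺a
    ... | y , y≢γa , plus  , _     , _    , y≺⁺a , _ = ⊥-elim (y≢γa (≺⁺⇒≡γ y≺⁺a))
    ... | _ , _    , minus , minus , _    , _    , ()
    ... | y , _    , minus , plus  , γγa≺⁺y , y≺⁻a , _ = y , y≺⁻a , sym (≺⁺⇒≡γ γγa≺⁺y)

    γδ∖δδ⊆γγ : ∀ {z} → z ∈γδ a → ¬ z ∈δδ a → z ≡ γ (γ a)
    γδ∖δδ⊆γγ (x , x≺⁻a , refl) z∉δδ with partner minus plus (γ-≺⁺-face x≺⁻a) x≺⁻a
    ... | y , _ , minus , minus , z≺⁻y , y≺⁻a , _ = ⊥-elim (z∉δδ (y , y≺⁻a , z≺⁻y))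
    ... | y , _ , plus  , plus  , z≺⁺y , y≺⁺a , _ = trans (≺⁺⇒≡γ z≺⁺y) (cong γ (≺⁺⇒≡γ y≺⁺a))
    ... | _ , _ , minus , plus  , _    , _    , ()
    ... | _ , _ , plus  , minus , _    , _    , ()

    δγ⊆δδ : ∀ {z} → z ≺⁻ γ a → z ∈δδ a
    δγ⊆δδ z≺⁻γa with partner plus minus z≺⁻γa γa≺⁺a
    ... | y , y≢γa , plus  , _     , _    , y≺⁺a , _ = ⊥-elim (y≢γa (≺⁺⇒≡γ y≺⁺a))
    ... | y , _    , minus , minus , z≺⁻y , y≺⁻a , _ = y , y≺⁻a , z≺⁻y
    ... | _ , _    , minus , plus  , _    , _    , ()

    δδ∖γδ⊆δγ : ∀ {z} → z ∈δδ a → ¬ z ∈γδ a → z ≺⁻ γ a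
    δδ∖γδ⊆δγ {z} (x , x≺⁻a , z≺⁻x) z∉γδ with partner minus minus z≺⁻x x≺⁻a
    ... | y , _ , plus  , minus , z≺⁻y , y≺⁺a , _ = subst (z ≺⁻_) (≺⁺⇒≡γ y≺⁺a) z≺⁻y
    ... | y , _ , minus , plus  , z≺⁺y , y≺⁻a , _ = ⊥-elim (z∉γδ (y , y≺⁻a , sym (≺⁺⇒≡γ z≺⁺y)))
    ... | _ , _ , minus , minus , _    , _    , ()
    ... | _ , _ , plus  , plus  , _    , _    , ()

    γγ-characterisation : ∀ z → (z ≡ γ (γ a)) ⇔ (z ∈γδ a × ¬ z ∈δδ a)
    γγ-characterisation z =
      mk⇔ (λ { refl → γγ∈γδ , face-of-γ-∉γδ∩δδ (inj₂ γγa≺⁺γa) γγ∈γδ })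
          (uncurry γδ∖δδ⊆γγ)

    δγ-characterisation : ∀ z → (z ≺⁻ γ a) ⇔ (z ∈δδ a × ¬ z ∈γδ a)
    δγ-characterisation z =
      mk⇔ (λ z≺⁻γa → δγ⊆δδ z≺⁻γa , λ z∈γδ → face-of-γ-∉γδ∩δδ (inj₁ z≺⁻γa) z∈γδ (δγ⊆δδ z≺⁻γa))
          (uncurry δδ∖γδ⊆δγ)

mainTheorem6 : ∀ {n} (C : DendriticFaceComplex n) → let open DendriticFaceComplex C in
    ∀ a → 2 ≤ dim a →
      (∀ z → (z ≡ γ (γ a)) ⇔ ((∃ λ x → (x ≺⁻ a) × (γ x ≡ z)) × ¬ (∃ λ x → (x ≺⁻ a) × (z ≺⁻ x))))
      × (∀ z → (z ≺⁻ γ a) ⇔ ((∃ λ x → (x ≺⁻ a) × (z ≺⁻ x)) × ¬ (∃ λ x → (x ≺⁻ a) × (γ x ≡ z))))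
mainTheorem6 C a 2≤dim-a = γγ-characterisation 2≤dim-a , δγ-characterisation 2≤dim-a
  where open DendriticFaceComplex C using (pop; oriented-thin)
        open OrientedThinPOP pop oriented-thin
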